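{- Let $\Lambda\subseteq\mathcal{S}$ be such that $2\cdot1\in\Lambda$ and $\Lambda$ contains neither $\epsilon$ nor any signature of the form $n^1$ ($n\geq1$). (1) If there is no $k\geq1$ with $1^k\in\Lambda$, then $\mathbf{SFL}(\Lambda)=\mathbf{SFL}(2\cdot1)$. (2) Otherwise, letting $k\geq1$ be minimal with $1^k\in\Lambda$, we have $\mathbf{SFL}(\Lambda)=\mathbf{SFL}(2\cdot1,1^k)$.
   Context: A signature is either $\epsilon$ or $n_1^{m_1}\cdots n_k^{m_k}$ with integers $n_1>\cdots>n_k\geq1$, $m_i\geq1$; $2\cdot1$ denotes $2^1 1^1$, $n^1$ a single entry $n$, and $1^k$ $k$ entries equal to $1$. The starlike tree $\mathbb{T}_\alpha$ is a root together with, for each $i$, $m_i$ chains of $n_i$ elements, pairwise disjoint and incomparable and above the root ($\mathbb{T}_\epsilon$ a point; $\mathbb{T}_{n^1}$ is a chain of $n+1$ elements). $\chi(Q)$ is the Jankov–Fine formula of a finite rooted poset $Q$: a poset validates $\chi(Q)$ iff there is no surjective p-morphism from an upward-closed subset of it onto $Q$. $\mathcal{S}$ is the set of signatures other than $1^2$, and for $\Lambda\subseteq\mathcal{S}$, $\mathbf{SFL}(\Lambda)$ is the logic axiomatised by $\mathbf{IPC}$ plus $\chi(\mathbb{T}_\alpha)$, $\alpha\in\Lambda$; $\mathbf{SFL}(\alpha_1,\dots,\alpha_r)=\mathbf{SFL}(\{\alpha_1,\dots,\alpha_r\})$. -}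

module Defs where

open import Data.Nat using (ℕ; zero; suc; _+_; _*_; _∸_; _≤_; _<_; _<ᵇ_; _≤ᵇ_; _≡ᵇ_)
open import Data.Bool using (Bool; true; false; _∧_; _∨_; not; if_then_else_)
open import Data.Fin using (Fin; toℕ)
open import Data.Vec using (Vec; []; _∷_; lookup; tabulate; zipWith; replicate)
open import Data.List using (List; []; _∷_; _++_; map; concatMap; allFin; cartesianProduct; foldr; filter)
import Data.List as L
open import Data.Product using (_×_; _,_)
open import Data.Maybe using (Maybe; just; nothing)
open import Data.Sum using (_⊎_)
open import Relation.Binary.PropositionalEquality using (_≡_; _≢_)
open import Relation.Nullary using (¬_)
open import Function using (_⇔_)

infixr 6 _∧'_
infixr 5 _∨'_
infixr 4 _⇒_
infix 3 _⇔'_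
infix 7 ¬'_

allB : {A : Set} → (A → Bool) → List A → Bool
allB f = foldr (λ x b → f x ∧ b) true

sumℕ : List ℕ → ℕ
sumℕ = foldr _+_ 0

data Formula : Set where
  var  : ℕ → Formula
  ⊥'   : Formula
  _∧'_ : Formula → Formula → Formula
  _∨'_ : Formula → Formula → Formula
  _⇒_  : Formula → Formula → Formula

⊤' : Formula
⊤' = ⊥' ⇒ ⊥'

_⇔'_ : Formula → Formula → Formula
A ⇔' B = (A ⇒ B) ∧' (B ⇒ A)

¬'_ : Formula → Formula
¬' A = A ⇒ ⊥'

⋀ : List Formula → Formula
⋀ []       = ⊤'
⋀ (A ∷ As) = A ∧' ⋀ As

_[_] : Formula → (ℕ → Formula) → Formula
var x    [ σ ] = σ x
⊥'       [ σ ] = ⊥'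
(A ∧' B) [ σ ] = A [ σ ] ∧' B [ σ ]
(A ∨' B) [ σ ] = A [ σ ] ∨' B [ σ ]
(A ⇒ B)  [ σ ] = A [ σ ] ⇒ B [ σ ]

record FinRootedPoset : Set where
  field
    size : ℕ
    _≼_  : Fin size → Fin size → Bool
    root : Fin size

allSubsets : (n : ℕ) → List (Vec Bool n)
allSubsets zero    = [] ∷ []
allSubsets (suc n) = map (false ∷_) (allSubsets n) ++ map (true ∷_) (allSubsets n)

-- injective coding of a characteristic vector as a natural number
code : ∀ {n} → Vec Bool n → ℕ
code []          = 0
code (false ∷ v) = 2 * code v
code (true ∷ v)  = suc (2 * code v)

module Jankov (Q : FinRootedPoset) where
  open FinRootedPoset Q

  pts : List (Fin size)
  pts = allFin size

  Sub : Set
  Sub = Vec Bool size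

  isUpset : Sub → Bool
  isUpset a = allB (λ x → allB (λ y → not (lookup a x ∧ (x ≼ y)) ∨ lookup a y) pts) pts

  Ups : List Sub
  Ups = filter (λ a → Data.Bool._≟_ (isUpset a) true) (allSubsets size)

  _∩_ _∪_ _⇛_ : Sub → Sub → Sub
  a ∩ b = zipWith _∧_ a b
  a ∪ b = zipWith _∨_ a b
  a ⇛ b = tabulate (λ x → allB (λ y → not ((x ≼ y) ∧ lookup a y) ∨ lookup b y) pts)

  ∅ : Sub
  ∅ = replicate size false

  neg : Sub → Sub
  neg a = a ⇛ ∅

  -- the second greatest element of Up(Q): Q minus its root
  s : Sub
  s = tabulate (λ x → not (toℕ x ≡ᵇ toℕ root))

  p : Sub → Formula
  p a = var (code a)

  conds : List Formula
  conds = concatMap (λ { (a , b) →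
              (p (a ∩ b) ⇔' (p a ∧' p b))
            ∷ (p (a ∪ b) ⇔' (p a ∨' p b))
            ∷ (p (a ⇛ b) ⇔' (p a ⇒ p b))
            ∷ (p (neg a) ⇔' ¬' p a)
            ∷ [] }) (cartesianProduct Ups Ups)

  χ : Formula
  χ = ⋀ conds ⇒ p s

open Jankov using (χ) public

-- Signatures: n₁^m₁ ⋯ n_k^m_k written as the list (n₁ , m₁) ∷ ⋯ ∷ (n_k , m_k) ∷ []
-- ε is [].

Signature : Set
Signature = List (ℕ × ℕ)

data StrictDec : Signature → Set where
  sd[]  : StrictDec []
  sd1   : ∀ {n m} → StrictDec ((n , m) ∷ [])
  sd∷   : ∀ {n m n' m' α} → n' < n → StrictDec ((n' , m') ∷ α) → StrictDec ((n , m) ∷ (n' , m') ∷ α)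

data AllPos : Signature → Set where
  ap[] : AllPos []
  ap∷  : ∀ {n m α} → 1 ≤ n → 1 ≤ m → AllPos α → AllPos ((n , m) ∷ α)

ValidSig : Signature → Set
ValidSig α = StrictDec α × AllPos α

sig-ε : Signature
sig-ε = []

sig-2·1 : Signature
sig-2·1 = (2 , 1) ∷ (1 , 1) ∷ []

sig-n¹ : ℕ → Signature
sig-n¹ n = (n , 1) ∷ []

sig-1^ : ℕ → Signature
sig-1^ k = (1 , k) ∷ []

In𝒮 : Signature → Set
In𝒮 α = ValidSig α × α ≢ sig-1^ 2

-- The starlike tree 𝕋_α.  Elements: Fin (1 + Σ chain lengths);
-- index 0 is the root, then the chains one after another, each listed
-- from its lowest element (just above the root) upwards.

chainLengths : Signature → List ℕ
chainLengths = concatMap (λ { (n , m) → L.replicate m n })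

-- locate the i-th non-root element: (chain index , position in chain)
locate : List ℕ → ℕ → Maybe (ℕ × ℕ)
locate []      i = nothing
locate (l ∷ ls) i = if i <ᵇ l then just (0 , i) else shift (locate ls (i ∸ l))
  where
  shift : Maybe (ℕ × ℕ) → Maybe (ℕ × ℕ)
  shift nothing        = nothing
  shift (just (c , q)) = just (suc c , q)

leqℕ : List ℕ → ℕ → ℕ → Bool
leqℕ ls zero    j       = true
leqℕ ls (suc i) zero    = false
leqℕ ls (suc i) (suc j) with locate ls i | locate ls j
... | just (c , q) | just (c' , q') = (c ≡ᵇ c') ∧ (q ≤ᵇ q')
... | _            | _              = false

𝕋 : Signature → FinRootedPoset
𝕋 α = record
  { size = suc (sumℕ (chainLengths α))
  ; _≼_  = λ x y → leqℕ (chainLengths α) (toℕ x) (toℕ y)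
  ; root = Fin.zero
  }
  where import Data.Fin as Fin

data _⊢_ (Λ : Signature → Set) : Formula → Set where
  ax-K   : ∀ {A B} → Λ ⊢ (A ⇒ B ⇒ A)
  ax-S   : ∀ {A B C} → Λ ⊢ ((A ⇒ B ⇒ C) ⇒ (A ⇒ B) ⇒ A ⇒ C)
  ax-∧I  : ∀ {A B} → Λ ⊢ (A ⇒ B ⇒ A ∧' B)
  ax-∧E₁ : ∀ {A B} → Λ ⊢ (A ∧' B ⇒ A)
  ax-∧E₂ : ∀ {A B} → Λ ⊢ (A ∧' B ⇒ B)
  ax-∨I₁ : ∀ {A B} → Λ ⊢ (A ⇒ A ∨' B)
  ax-∨I₂ : ∀ {A B} → Λ ⊢ (B ⇒ A ∨' B)
  ax-∨E  : ∀ {A B C} → Λ ⊢ ((A ⇒ C) ⇒ (B ⇒ C) ⇒ A ∨' B ⇒ C)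
  ax-⊥E  : ∀ {A} → Λ ⊢ (⊥' ⇒ A)
  ax-χ   : ∀ {α} → Λ α → Λ ⊢ χ (𝕋 α)
  mp     : ∀ {A B} → Λ ⊢ (A ⇒ B) → Λ ⊢ A → Λ ⊢ B
  subst  : ∀ {A} (σ : ℕ → Formula) → Λ ⊢ A → Λ ⊢ (A [ σ ])

_≈SFL_ : (Λ Λ' : Signature → Set) → Set
Λ ≈SFL Λ' = ∀ A → (Λ ⊢ A) ⇔ (Λ' ⊢ A)

⟦_⟧ : List Signature → Signature → Set
⟦ [] ⟧     α = Data.Empty.⊥ where import Data.Empty
⟦ β ∷ βs ⟧ α = (α ≡ β) ⊎ ⟦ βs ⟧ α

{-# OPTIONS --safe #-}
module Submission where

-- A root-preserving p-morphism f from P onto Q yields χ(Q) ⊢ χ(P): substituting p_(f⁻¹ a) for p_a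
-- sends the conjuncts of χ(Q) to conjuncts of χ(P), because f⁻¹ is a Heyting homomorphism
-- Up(Q) → Up(P), and f⁻¹ of the non-root part of Q lies in the non-root part of P.
-- A tree 𝕋_α whose signature is none of ε, n¹, 1^m has two chains, the first of length ≥ 2, and
-- collapses onto 𝕋(2·1); and 𝕋(1^m) folds onto 𝕋(1^k) whenever k ≤ m.  So every axiom of SFL(Λ)
-- follows from χ(𝕋(2·1)), together with χ(𝕋(1^k)) for the least k with 1^k ∈ Λ if there is one.

open import Defs
open import Data.Bool using (Bool; true; false; _∧_; _∨_; not; T; _≟_)
open import Data.Bool.Properties using (∨-zeroʳ; T-≡)
open import Data.Empty using (⊥-elim)
open import Data.Fin using (Fin; toℕ; fromℕ<)
import Data.Fin as Fin
open import Data.Fin.Properties using (toℕ-injective; toℕ<n; toℕ-fromℕ<)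
open import Data.List using (List; []; _∷_; map; allFin; cartesianProduct)
open import Data.List.Membership.Propositional using (_∈_; find; lose)
open import Data.List.Membership.Propositional.Properties
  using (∈-map⁺; ∈-map⁻; ∈-filter⁺; ∈-filter⁻; ∈-concatMap⁺; ∈-concatMap⁻;
         ∈-cartesianProduct⁺; ∈-cartesianProduct⁻; ∈-allFin)
open import Data.List.Relation.Unary.Any using (here; there)
open import Data.List.Relation.Unary.Any.Properties using (++⁺ˡ; ++⁺ʳ)
open import Data.Maybe using (Maybe; just; nothing)
open import Data.Nat using (ℕ; zero; suc; _+_; _*_; _∸_; _⊓_; _≤_; _<_; _≤?_; _≡ᵇ_; _<ᵇ_; _≤ᵇ_; z≤n; s≤s; ⌊_/2⌋)
import Data.Nat.Properties as ℕ
open import Data.Product using (_×_; _,_; Σ; proj₁; proj₂)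
open import Data.Sum using (inj₁; inj₂)
open import Data.Vec using (Vec; []; _∷_; lookup; tabulate; zipWith)
open import Data.Vec.Properties using (lookup∘tabulate; tabulate∘lookup; tabulate-cong; lookup-zipWith; lookup-replicate)
open import Function using (_∘_)
open import Function.Bundles using (mk⇔; Equivalence)
open import Relation.Binary.PropositionalEquality using (_≡_; _≢_; refl; sym; trans; cong; cong₂; module ≡-Reasoning)
import Relation.Binary.PropositionalEquality as Eq
open import Relation.Nullary using (¬_; yes; no)

module _ {Λ : Signature → Set} where

  ⊢-id : ∀ {A} → Λ ⊢ (A ⇒ A)
  ⊢-id {A} = mp (mp (ax-S {B = A ⇒ A}) ax-K) ax-K

  ⊢-const : ∀ {A C} → Λ ⊢ A → Λ ⊢ (C ⇒ A)
  ⊢-const = mp ax-K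

  ⊢-app : ∀ {A B C} → Λ ⊢ (C ⇒ A ⇒ B) → Λ ⊢ (C ⇒ A) → Λ ⊢ (C ⇒ B)
  ⊢-app d e = mp (mp ax-S d) e

  ⊢-∘ : ∀ {A B C} → Λ ⊢ (A ⇒ B) → Λ ⊢ (B ⇒ C) → Λ ⊢ (A ⇒ C)
  ⊢-∘ ab bc = ⊢-app (⊢-const bc) ab

  ⊢-⟨_,_⟩ : ∀ {A B C} → Λ ⊢ (C ⇒ A) → Λ ⊢ (C ⇒ B) → Λ ⊢ (C ⇒ A ∧' B)
  ⊢-⟨ ca , cb ⟩ = ⊢-app (⊢-∘ ca ax-∧I) cb

  ⋀-proj : ∀ {A L} → A ∈ L → Λ ⊢ (⋀ L ⇒ A)
  ⋀-proj (here refl) = ax-∧E₁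
  ⋀-proj (there A∈L) = ⊢-∘ ax-∧E₂ (⋀-proj A∈L)

  ⋀-⊆ : ∀ {L} L′ → (∀ {A} → A ∈ L′ → A ∈ L) → Λ ⊢ (⋀ L ⇒ ⋀ L′)
  ⋀-⊆ []       _    = ⊢-const ⊢-id
  ⋀-⊆ (A ∷ L′) L′⊆L = ⊢-⟨ ⋀-proj (L′⊆L (here refl)) , ⋀-⊆ L′ (L′⊆L ∘ there) ⟩

⋀-[] : ∀ L σ → (⋀ L) [ σ ] ≡ ⋀ (map (_[ σ ]) L)
⋀-[] []      σ = refl
⋀-[] (A ∷ L) σ = cong (A [ σ ] ∧'_) (⋀-[] L σ)

⊢-resp-axioms : ∀ {Λ Λ′ : Signature → Set} → (∀ α → Λ α → Λ′ ⊢ χ (𝕋 α)) → ∀ {A} → Λ ⊢ A → Λ′ ⊢ A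
⊢-resp-axioms ax ax-K        = ax-K
⊢-resp-axioms ax ax-S        = ax-S
⊢-resp-axioms ax ax-∧I       = ax-∧I
⊢-resp-axioms ax ax-∧E₁      = ax-∧E₁
⊢-resp-axioms ax ax-∧E₂      = ax-∧E₂
⊢-resp-axioms ax ax-∨I₁      = ax-∨I₁
⊢-resp-axioms ax ax-∨I₂      = ax-∨I₂
⊢-resp-axioms ax ax-∨E       = ax-∨E
⊢-resp-axioms ax ax-⊥E       = ax-⊥E
⊢-resp-axioms ax (ax-χ α∈Λ)  = ax _ α∈Λ
⊢-resp-axioms ax (mp d e)    = mp (⊢-resp-axioms ax d) (⊢-resp-axioms ax e)
⊢-resp-axioms ax (subst σ d) = subst σ (⊢-resp-axioms ax d)

∧-true⁻ : ∀ {a b} → a ∧ b ≡ true → a ≡ true × b ≡ true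
∧-true⁻ {true} b≡true = refl , b≡true

∧-true⁺ : ∀ {a b} → a ≡ true → b ≡ true → a ∧ b ≡ true
∧-true⁺ refl refl = refl

implies⁻ : ∀ u v w → not (u ∧ v) ∨ w ≡ true → u ≡ true → v ≡ true → w ≡ true
implies⁻ true true w e refl refl = e

implies⁺ : ∀ u v w → (u ≡ true → v ≡ true → w ≡ true) → not (u ∧ v) ∨ w ≡ true
implies⁺ true  true  w k = k refl refl
implies⁺ true  false w k = refl
implies⁺ false v     w k = refl

Bool-ext : ∀ {a b} → (a ≡ true → b ≡ true) → (b ≡ true → a ≡ true) → a ≡ b
Bool-ext {true}  {true}  _ _ = refl
Bool-ext {true}  {false} f _ = sym (f refl)
Bool-ext {false} {true}  _ g = g refl
Bool-ext {false} {false} _ _ = refl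

module _ {A : Set} (g : A → Bool) where

  allB⁻ : ∀ xs → allB g xs ≡ true → ∀ {x} → x ∈ xs → g x ≡ true
  allB⁻ (y ∷ xs) e (here refl) = proj₁ (∧-true⁻ e)
  allB⁻ (y ∷ xs) e (there x∈) = allB⁻ xs (proj₂ (∧-true⁻ {g y} e)) x∈

  allB⁺ : ∀ xs → (∀ {x} → x ∈ xs → g x ≡ true) → allB g xs ≡ true
  allB⁺ []       _ = refl
  allB⁺ (y ∷ xs) k = ∧-true⁺ (k (here refl)) (allB⁺ xs (k ∘ there))

allB-allFin⁻ : ∀ {n} (g : Fin n → Bool) → allB g (allFin n) ≡ true → ∀ x → g x ≡ true
allB-allFin⁻ g e x = allB⁻ g (allFin _) e (∈-allFin x)

allB-allFin⁺ : ∀ {n} (g : Fin n → Bool) → (∀ x → g x ≡ true) → allB g (allFin n) ≡ true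
allB-allFin⁺ g k = allB⁺ g (allFin _) (λ {x} _ → k x)

≡ᵇ-refl : ∀ n → (n ≡ᵇ n) ≡ true
≡ᵇ-refl n = Equivalence.to T-≡ (ℕ.≡⇒≡ᵇ n n refl)

≤ᵇ-refl : ∀ n → (n ≤ᵇ n) ≡ true
≤ᵇ-refl n = Equivalence.to T-≡ (ℕ.≤⇒≤ᵇ (ℕ.≤-refl {n}))

<ᵇ-irrefl : ∀ n → (n <ᵇ n) ≡ false
<ᵇ-irrefl zero    = refl
<ᵇ-irrefl (suc n) = <ᵇ-irrefl n

lookup-ext : ∀ {A : Set} {n} (u v : Vec A n) → (∀ i → lookup u i ≡ lookup v i) → u ≡ v
lookup-ext u v u≗v = begin
  u                  ≡⟨ sym (tabulate∘lookup u) ⟩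
  tabulate (lookup u) ≡⟨ tabulate-cong u≗v ⟩
  tabulate (lookup v) ≡⟨ tabulate∘lookup v ⟩
  v                  ∎
  where open ≡-Reasoning

∈-allSubsets : ∀ {n} (v : Vec Bool n) → v ∈ allSubsets n
∈-allSubsets []                = here refl
∈-allSubsets (false ∷ v)       = ++⁺ˡ (∈-map⁺ (false ∷_) (∈-allSubsets v))
∈-allSubsets {suc n} (true ∷ v) = ++⁺ʳ (map (false ∷_) (allSubsets n)) (∈-map⁺ (true ∷_) (∈-allSubsets v))

odd : ℕ → Bool
odd zero          = false
odd (suc zero)    = true
odd (suc (suc n)) = odd n

decode : ∀ n → ℕ → Vec Bool n
decode zero    c = []
decode (suc n) c = odd c ∷ decode n ⌊ c /2⌋

halve-2* : ∀ c → odd (2 * c) ≡ false × ⌊ 2 * c /2⌋ ≡ c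
halve-2* zero    = refl , refl
halve-2* (suc c) rewrite ℕ.+-suc c (c + 0) = let o , h = halve-2* c in o , cong suc h

halve-1+2* : ∀ c → odd (suc (2 * c)) ≡ true × ⌊ suc (2 * c) /2⌋ ≡ c
halve-1+2* zero    = refl , refl
halve-1+2* (suc c) rewrite ℕ.+-suc c (c + 0) = let o , h = halve-1+2* c in o , cong suc h

decode∘code : ∀ {n} (v : Vec Bool n) → decode n (code v) ≡ v
decode∘code []          = refl
decode∘code (false ∷ v) rewrite proj₁ (halve-2* (code v)) | proj₂ (halve-2* (code v)) =
  cong (false ∷_) (decode∘code v)
decode∘code (true ∷ v)  rewrite proj₁ (halve-1+2* (code v)) | proj₂ (halve-1+2* (code v)) =
  cong (true ∷_) (decode∘code v)

RootMinimal : FinRootedPoset → Set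
RootMinimal Q = ∀ x → (x ≼ root) ≡ true → x ≡ root
  where open FinRootedPoset Q

module JankovProperties (Q : FinRootedPoset) where
  open FinRootedPoset Q
  open Jankov Q

  isUpset⁻ : ∀ a → isUpset a ≡ true → ∀ x y → lookup a x ≡ true → (x ≼ y) ≡ true → lookup a y ≡ true
  isUpset⁻ a up x y = implies⁻ _ _ _ (allB-allFin⁻ _ (allB-allFin⁻ _ up x) y)

  isUpset⁺ : ∀ a → (∀ x y → lookup a x ≡ true → (x ≼ y) ≡ true → lookup a y ≡ true) → isUpset a ≡ true
  isUpset⁺ a k = allB-allFin⁺ _ (λ x → allB-allFin⁺ _ (λ y → implies⁺ _ _ _ (k x y)))

  ∈Ups⁻ : ∀ {a} → a ∈ Ups → isUpset a ≡ true
  ∈Ups⁻ a∈ = proj₂ (∈-filter⁻ (λ a → isUpset a ≟ true) {xs = allSubsets size} a∈)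

  ∈Ups⁺ : ∀ {a} → isUpset a ≡ true → a ∈ Ups
  ∈Ups⁺ up = ∈-filter⁺ (λ a → isUpset a ≟ true) (∈-allSubsets _) up

  lookup-s : ∀ x → lookup s x ≡ not (toℕ x ≡ᵇ toℕ root)
  lookup-s = lookup∘tabulate (λ x → not (toℕ x ≡ᵇ toℕ root))

  lookup-s-root : lookup s root ≡ false
  lookup-s-root rewrite lookup-s root | ≡ᵇ-refl (toℕ root) = refl

  lookup-s≡false⇒root : ∀ x → lookup s x ≡ false → x ≡ root
  lookup-s≡false⇒root x e rewrite lookup-s x =
    toℕ-injective (ℕ.≡ᵇ⇒≡ (toℕ x) (toℕ root) (Equivalence.from T-≡ (not-false e)))
    where
    not-false : ∀ {b} → not b ≡ false → b ≡ true
    not-false {true} _ = refl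

  s∈Ups : RootMinimal Q → s ∈ Ups
  s∈Ups minimal = ∈Ups⁺ (isUpset⁺ s upward)
    where
    upward : ∀ x y → lookup s x ≡ true → (x ≼ y) ≡ true → lookup s y ≡ true
    upward x y sx x≼y with lookup s y in sy
    ... | true  = refl
    ... | false with refl ← lookup-s≡false⇒root y sy
                with refl ← minimal x x≼y
                with () ← trans (sym sx) lookup-s-root

  HeytingConds : Sub → Sub → (Formula → Set) → Set
  HeytingConds a b R = R (p (a ∩ b) ⇔' (p a ∧' p b)) × R (p (a ∪ b) ⇔' (p a ∨' p b))
                     × R (p (a ⇛ b) ⇔' (p a ⇒ p b)) × R (p (neg a) ⇔' ¬' p a)

  ∈-conds : ∀ {a b} → a ∈ Ups → b ∈ Ups → HeytingConds a b (_∈ conds)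
  ∈-conds a∈ b∈ = lift (here refl) , lift (there (here refl))
                , lift (there (there (here refl))) , lift (there (there (there (here refl))))
    where
    lift : ∀ {F} → F ∈ _ → F ∈ conds
    lift F∈ = ∈-concatMap⁺ _ (lose (∈-cartesianProduct⁺ a∈ b∈) F∈)

  conds-all : (R : Formula → Set) → (∀ {a b} → a ∈ Ups → b ∈ Ups → HeytingConds a b R)
    → ∀ {A} → A ∈ conds → R A
  conds-all R k A∈
    with (a , b) , ab∈ , A∈ab ← find (∈-concatMap⁻ _ {xs = cartesianProduct Ups Ups} A∈)
    with a∈ , b∈ ← ∈-cartesianProduct⁻ Ups Ups ab∈
    with r∩ , r∪ , r⇛ , r¬ ← k a∈ b∈
    with A∈ab
  ... | here refl                         = r∩
  ... | there (here refl)                 = r∪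
  ... | there (there (here refl))         = r⇛
  ... | there (there (there (here refl))) = r¬

-- Pulling χ back along p-morphisms

record PMorphism (P Q : FinRootedPoset) : Set where
  private
    module P = FinRootedPoset P
    module Q = FinRootedPoset Q
  field
    fun   : Fin P.size → Fin Q.size
    forth : ∀ x y → (x P.≼ y) ≡ true → (fun x Q.≼ fun y) ≡ true
    back  : ∀ x w → (fun x Q.≼ w) ≡ true → Σ (Fin P.size) λ z → (x P.≼ z) ≡ true × fun z ≡ w
    fun-root : fun P.root ≡ Q.root

module _ {P Q : FinRootedPoset} (f : PMorphism P Q) where
  private
    module P = FinRootedPoset P
    module Q = FinRootedPoset Q
    module JP = Jankov P
    module JQ = Jankov Q
    module PP = JankovProperties P
    module PQ = JankovProperties Q
  open PMorphism f

  preimage : Vec Bool Q.size → Vec Bool P.size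
  preimage a = tabulate (lookup a ∘ fun)

  lookup-preimage : ∀ a x → lookup (preimage a) x ≡ lookup a (fun x)
  lookup-preimage a = lookup∘tabulate (lookup a ∘ fun)

  preimage-zipWith : ∀ (_•_ : Bool → Bool → Bool) a b →
    preimage (zipWith _•_ a b) ≡ zipWith _•_ (preimage a) (preimage b)
  preimage-zipWith _•_ a b = lookup-ext _ _ λ x → begin
    lookup (preimage (zipWith _•_ a b)) x              ≡⟨ lookup-preimage (zipWith _•_ a b) x ⟩
    lookup (zipWith _•_ a b) (fun x)                   ≡⟨ lookup-zipWith _•_ (fun x) a b ⟩
    lookup a (fun x) • lookup b (fun x)                ≡⟨ sym (cong₂ _•_ (lookup-preimage a x) (lookup-preimage b x)) ⟩
    lookup (preimage a) x • lookup (preimage b) x      ≡⟨ sym (lookup-zipWith _•_ x (preimage a) (preimage b)) ⟩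
    lookup (zipWith _•_ (preimage a) (preimage b)) x   ∎
    where open ≡-Reasoning

  preimage-∅ : preimage JQ.∅ ≡ JP.∅
  preimage-∅ = lookup-ext _ _ λ x →
    trans (lookup-preimage JQ.∅ x) (trans (lookup-replicate (fun x) false) (sym (lookup-replicate x false)))

  -- forth gives one inclusion, back the other.
  preimage-⇛ : ∀ a b → preimage (a JQ.⇛ b) ≡ preimage a JP.⇛ preimage b
  preimage-⇛ a b = lookup-ext _ _ λ x → begin
    lookup (preimage (a JQ.⇛ b)) x     ≡⟨ lookup-preimage (a JQ.⇛ b) x ⟩
    lookup (a JQ.⇛ b) (fun x)          ≡⟨ lookup∘tabulate (λ w → impQ w) (fun x) ⟩
    impQ (fun x)                       ≡⟨ Bool-ext (⊆ x) (⊇ x) ⟩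
    impP x                             ≡⟨ sym (lookup∘tabulate impP x) ⟩
    lookup (preimage a JP.⇛ preimage b) x ∎
    where
    open ≡-Reasoning
    impQ : Fin Q.size → Bool
    impQ w = allB (λ y → not ((w Q.≼ y) ∧ lookup a y) ∨ lookup b y) JQ.pts
    impP : Fin P.size → Bool
    impP x = allB (λ z → not ((x P.≼ z) ∧ lookup (preimage a) z) ∨ lookup (preimage b) z) JP.pts

    ⊆ : ∀ x → impQ (fun x) ≡ true → impP x ≡ true
    ⊆ x e = allB-allFin⁺ _ λ z → implies⁺ _ _ _ λ x≼z az →
      Eq.subst (_≡ true) (sym (lookup-preimage b z))
        (implies⁻ _ _ _ (allB-allFin⁻ _ e (fun z)) (forth x z x≼z)
                  (Eq.subst (_≡ true) (lookup-preimage a z) az))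

    ⊇ : ∀ x → impP x ≡ true → impQ (fun x) ≡ true
    ⊇ x e = allB-allFin⁺ _ λ y → implies⁺ _ _ _ λ fx≼y ay → lifted y fx≼y ay (back x y fx≼y)
      where
      lifted : ∀ y → (fun x Q.≼ y) ≡ true → lookup a y ≡ true
        → Σ (Fin P.size) (λ z → (x P.≼ z) ≡ true × fun z ≡ y) → lookup b y ≡ true
      lifted .(fun z) _ ay (z , x≼z , refl) =
        Eq.subst (_≡ true) (lookup-preimage b z)
          (implies⁻ _ _ _ (allB-allFin⁻ _ e z) x≼z (Eq.subst (_≡ true) (sym (lookup-preimage a z)) ay))

  preimage-neg : ∀ a → preimage (JQ.neg a) ≡ JP.neg (preimage a)
  preimage-neg a = trans (preimage-⇛ a JQ.∅) (cong (preimage a JP.⇛_) preimage-∅)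

  preimage-∈Ups : ∀ {a} → a ∈ JQ.Ups → preimage a ∈ JP.Ups
  preimage-∈Ups {a} a∈ = PP.∈Ups⁺ (PP.isUpset⁺ (preimage a) λ x y ax x≼y →
    Eq.subst (_≡ true) (sym (lookup-preimage a y))
      (PQ.isUpset⁻ a (PQ.∈Ups⁻ a∈) (fun x) (fun y) (Eq.subst (_≡ true) (lookup-preimage a x) ax) (forth x y x≼y)))

  preimage-s∪s : preimage JQ.s JP.∪ JP.s ≡ JP.s
  preimage-s∪s = lookup-ext _ _ λ x → trans (lookup-zipWith _∨_ x (preimage JQ.s) JP.s) (absorb x)
    where
    absorb : ∀ x → lookup (preimage JQ.s) x ∨ lookup JP.s x ≡ lookup JP.s x
    absorb x with lookup JP.s x in sx
    ... | true  = ∨-zeroʳ _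
    ... | false with refl ← PP.lookup-s≡false⇒root x sx
      rewrite lookup-preimage JQ.s P.root | fun-root | PQ.lookup-s-root = refl

  χ-pullback : RootMinimal P → RootMinimal Q → ∀ {Λ} → Λ ⊢ χ Q → Λ ⊢ χ P
  χ-pullback minimalP minimalQ {Λ} ⊢χQ = ⊢-app s-absorbs (⊢-∘ conds⇒preimage-s ax-∨I₁)
    where
    σ : ℕ → Formula
    σ c = var (code (preimage (decode Q.size c)))

    σ-conds : ∀ {A} → A ∈ map (_[ σ ]) JQ.conds → A ∈ JP.conds
    σ-conds A∈ with B , B∈ , refl ← ∈-map⁻ (_[ σ ]) A∈ = PQ.conds-all (λ B → B [ σ ] ∈ JP.conds) pulled B∈
      where
      pulled : ∀ {a b} → a ∈ JQ.Ups → b ∈ JQ.Ups → PQ.HeytingConds a b (λ B → B [ σ ] ∈ JP.conds)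
      pulled {a} {b} a∈ b∈
        rewrite decode∘code (a JQ.∩ b) | decode∘code (a JQ.∪ b) | decode∘code (a JQ.⇛ b)
              | decode∘code (JQ.neg a) | decode∘code a | decode∘code b
              | preimage-zipWith _∧_ a b | preimage-zipWith _∨_ a b | preimage-⇛ a b | preimage-neg a
        = PP.∈-conds (preimage-∈Ups a∈) (preimage-∈Ups b∈)

    χQ[σ] : Λ ⊢ (⋀ (map (_[ σ ]) JQ.conds) ⇒ JP.p (preimage JQ.s))
    χQ[σ] = Eq.subst (λ v → Λ ⊢ (⋀ (map (_[ σ ]) JQ.conds) ⇒ var (code (preimage v)))) (decode∘code JQ.s)
              (Eq.subst (λ F → Λ ⊢ (F ⇒ σ (code JQ.s))) (⋀-[] JQ.conds σ) (subst σ ⊢χQ))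

    conds⇒preimage-s : Λ ⊢ (⋀ JP.conds ⇒ JP.p (preimage JQ.s))
    conds⇒preimage-s = ⊢-∘ (⋀-⊆ (map (_[ σ ]) JQ.conds) σ-conds) χQ[σ]

    s-absorbs : Λ ⊢ (⋀ JP.conds ⇒ (JP.p (preimage JQ.s) ∨' JP.p JP.s) ⇒ JP.p JP.s)
    s-absorbs = ⊢-∘ (⋀-proj ∪-cond) ax-∧E₂
      where
      ∪-cond : (JP.p JP.s ⇔' (JP.p (preimage JQ.s) ∨' JP.p JP.s)) ∈ JP.conds
      ∪-cond = Eq.subst (λ v → (JP.p v ⇔' (JP.p (preimage JQ.s) ∨' JP.p JP.s)) ∈ JP.conds) preimage-s∪s
                 (proj₁ (proj₂ (PP.∈-conds (preimage-∈Ups (PQ.s∈Ups minimalQ)) (PP.s∈Ups minimalP))))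

-- Starlike trees by chain lengths; 𝕋 α is definitionally TL (chainLengths α)

TL : List ℕ → FinRootedPoset
TL ls = record
  { size = suc (sumℕ ls)
  ; _≼_  = λ x y → leqℕ ls (toℕ x) (toℕ y)
  ; root = Fin.zero
  }

TL-rootMinimal : ∀ ls → RootMinimal (TL ls)
TL-rootMinimal ls Fin.zero _ = refl

record IndexPMorphism (ls ls′ : List ℕ) : Set where
  field
    idx       : ℕ → ℕ
    idx-root  : idx 0 ≡ 0
    idx-bound : ∀ i → i < suc (sumℕ ls) → idx i < suc (sumℕ ls′)
    idx-forth : ∀ i j → i < suc (sumℕ ls) → j < suc (sumℕ ls) →
                leqℕ ls i j ≡ true → leqℕ ls′ (idx i) (idx j) ≡ true
    idx-back  : ∀ i w → i < suc (sumℕ ls) → w < suc (sumℕ ls′) → leqℕ ls′ (idx i) w ≡ true →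
                Σ ℕ λ j → j < suc (sumℕ ls) × leqℕ ls i j ≡ true × idx j ≡ w

toPMorphism : ∀ {ls ls′} → IndexPMorphism ls ls′ → PMorphism (TL ls) (TL ls′)
toPMorphism {ls} {ls′} F = record
  { fun      = fun
  ; forth    = λ x y x≼y → Eq.subst₂ (λ i j → leqℕ ls′ i j ≡ true) (sym (toℕ-fun x)) (sym (toℕ-fun y))
                             (idx-forth (toℕ x) (toℕ y) (toℕ<n x) (toℕ<n y) x≼y)
  ; back     = back
  ; fun-root = toℕ-injective (trans (toℕ-fun Fin.zero) idx-root)
  }
  where
  open IndexPMorphism F
  fun : Fin (suc (sumℕ ls)) → Fin (suc (sumℕ ls′))
  fun x = fromℕ< (idx-bound (toℕ x) (toℕ<n x))

  toℕ-fun : ∀ x → toℕ (fun x) ≡ idx (toℕ x)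
  toℕ-fun x = toℕ-fromℕ< (idx-bound (toℕ x) (toℕ<n x))

  back : ∀ x w → leqℕ ls′ (toℕ (fun x)) (toℕ w) ≡ true →
         Σ (Fin (suc (sumℕ ls))) λ z → leqℕ ls (toℕ x) (toℕ z) ≡ true × fun z ≡ w
  back x w fx≼w
    with j , j< , x≼j , idx-j ← idx-back (toℕ x) (toℕ w) (toℕ<n x) (toℕ<n w)
                                  (Eq.subst (λ i → leqℕ ls′ i (toℕ w) ≡ true) (toℕ-fun x) fx≼w)
    = fromℕ< j<
    , Eq.subst (λ k → leqℕ ls (toℕ x) k ≡ true) (sym (toℕ-fromℕ< j<)) x≼j
    , toℕ-injective (trans (toℕ-fun (fromℕ< j<)) (trans (cong idx (toℕ-fromℕ< j<)) idx-j))

χ-TL-pullback : ∀ {Λ ls ls′} → IndexPMorphism ls ls′ → Λ ⊢ χ (TL ls′) → Λ ⊢ χ (TL ls)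
χ-TL-pullback {ls = ls} {ls′} F = χ-pullback (toPMorphism F) (TL-rootMinimal ls) (TL-rootMinimal ls′)

leqℕ-suc⁻ : ∀ ls i j → leqℕ ls (suc i) (suc j) ≡ true →
  Σ ℕ λ c → Σ ℕ λ q → Σ ℕ λ q′ →
    locate ls i ≡ just (c , q) × locate ls j ≡ just (c , q′) × (q ≤ᵇ q′) ≡ true
leqℕ-suc⁻ ls i j e with locate ls i | locate ls j
... | just (c , q) | just (c′ , q′)
  with refl ← ℕ.≡ᵇ⇒≡ c c′ (Equivalence.from T-≡ (proj₁ (∧-true⁻ e)))
  = c , q , q′ , refl , refl , proj₂ (∧-true⁻ {c ≡ᵇ c} e)

leqℕ-suc⁺ : ∀ ls i j {c q q′} → locate ls i ≡ just (c , q) → locate ls j ≡ just (c , q′) →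
  (q ≤ᵇ q′) ≡ true → leqℕ ls (suc i) (suc j) ≡ true
leqℕ-suc⁺ ls i j {c} li lj q≤q′ rewrite li | lj = ∧-true⁺ (≡ᵇ-refl c) q≤q′

leqℕ-refl : ∀ ls i {c q} → locate ls i ≡ just (c , q) → leqℕ ls (suc i) (suc i) ≡ true
leqℕ-refl ls i {q = q} li = leqℕ-suc⁺ ls i i li li (≤ᵇ-refl q)

locate-defined : ∀ ls i → i < sumℕ ls → Σ ℕ λ c → Σ ℕ λ q → locate ls i ≡ just (c , q)
locate-defined (l ∷ ls) i i< with i <ᵇ l in i<ᵇl
... | true  = 0 , i , refl
... | false with locate ls (i ∸ l) | locate-defined ls (i ∸ l) i∸l<
  where
  i∸l< : i ∸ l < sumℕ ls
  i∸l< = ℕ.+-cancelˡ-< l (i ∸ l) (sumℕ ls)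
           (Eq.subst (_< l + sumℕ ls) (sym (ℕ.m+[n∸m]≡n l≤i)) i<)
    where
    l≤i : l ≤ i
    l≤i = ℕ.≮⇒≥ λ i<l → Eq.subst T i<ᵇl (ℕ.<⇒<ᵇ i<l)
...   | just (c , q) | _ = suc c , q , refl

-- Collapsing a tree with two chains, the first of length ≥ 2, onto 𝕋(2·1)

-- A point of chain c at height q goes to the bottom (1) or top (2) of the 2-chain if c = 0,
-- and to the 1-chain (3) otherwise.
collapse : Maybe (ℕ × ℕ) → ℕ
collapse (just (zero , zero))  = 1
collapse (just (zero , suc _)) = 2
collapse (just (suc _ , _))    = 3
collapse nothing               = 0

collapse<4 : ∀ m → collapse m < 4
collapse<4 (just (zero , zero))  = s≤s (s≤s z≤n)
collapse<4 (just (zero , suc _)) = s≤s (s≤s (s≤s z≤n))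
collapse<4 (just (suc _ , _))    = s≤s (s≤s (s≤s (s≤s z≤n)))
collapse<4 nothing               = s≤s z≤n

collapse-mono : ∀ c q q′ → (q ≤ᵇ q′) ≡ true →
  leqℕ (2 ∷ 1 ∷ []) (collapse (just (c , q))) (collapse (just (c , q′))) ≡ true
collapse-mono zero    zero    zero     _ = refl
collapse-mono zero    zero    (suc q′) _ = refl
collapse-mono zero    (suc q) (suc q′) _ = refl
collapse-mono (suc c) q       q′       _ = refl

onto-2·1 : ∀ n l ls → IndexPMorphism (suc (suc n) ∷ suc l ∷ ls) (2 ∷ 1 ∷ [])
onto-2·1 n l ls = record
  { idx       = idx
  ; idx-root  = refl
  ; idx-bound = idx-bound
  ; idx-forth = idx-forth
  ; idx-back  = idx-back
  }
  where
  ls₀ : List ℕ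
  ls₀ = suc (suc n) ∷ suc l ∷ ls

  idx : ℕ → ℕ
  idx zero    = 0
  idx (suc i) = collapse (locate ls₀ i)

  idx-bound : ∀ i → i < suc (sumℕ ls₀) → idx i < 4
  idx-bound zero    _ = s≤s z≤n
  idx-bound (suc i) _ = collapse<4 (locate ls₀ i)

  idx-forth : ∀ i j → i < suc (sumℕ ls₀) → j < suc (sumℕ ls₀) →
              leqℕ ls₀ i j ≡ true → leqℕ (2 ∷ 1 ∷ []) (idx i) (idx j) ≡ true
  idx-forth zero    j       _ _ _ = refl
  idx-forth (suc i) (suc j) _ _ i≼j with c , q , q′ , li , lj , q≤q′ ← leqℕ-suc⁻ ls₀ i j i≼j
    rewrite li | lj = collapse-mono c q q′ q≤q′

  2<size : 2 < suc (sumℕ ls₀)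
  2<size = s≤s (s≤s (s≤s z≤n))

  3+n<size : 3 + n < suc (sumℕ ls₀)
  3+n<size = s≤s (s≤s (s≤s (Eq.subst (suc n ≤_) (sym (ℕ.+-suc n (l + sumℕ ls))) (s≤s (ℕ.m≤m+n n _)))))

  idx-3+n : idx (3 + n) ≡ 3
  idx-3+n rewrite <ᵇ-irrefl n | ℕ.n∸n≡0 n = refl

  idx-back : ∀ i w → i < suc (sumℕ ls₀) → w < 4 → leqℕ (2 ∷ 1 ∷ []) (idx i) w ≡ true →
             Σ ℕ λ j → j < suc (sumℕ ls₀) × leqℕ ls₀ i j ≡ true × idx j ≡ w
  idx-back zero 0 _ _ _ = 0 , s≤s z≤n , refl , refl
  idx-back zero 1 _ _ _ = 1 , s≤s (s≤s z≤n) , refl , refl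
  idx-back zero 2 _ _ _ = 2 , 2<size , refl , refl
  idx-back zero 3 _ _ _ = 3 + n , 3+n<size , refl , idx-3+n
  idx-back zero (suc (suc (suc (suc w)))) _ (s≤s (s≤s (s≤s (s≤s ())))) _
  idx-back (suc i) w (s≤s i<) w<4 i≼w with c , q , li ← locate-defined ls₀ i i<
    = above c q li w w<4 (Eq.subst (λ m → leqℕ (2 ∷ 1 ∷ []) (collapse m) w ≡ true) li i≼w)
    where
    itself : ∀ {c q} → locate ls₀ i ≡ just (c , q) →
             Σ ℕ λ j → j < suc (sumℕ ls₀) × leqℕ ls₀ (suc i) j ≡ true × idx j ≡ collapse (just (c , q))
    itself li = suc i , s≤s i< , leqℕ-refl ls₀ i li , cong collapse li

    above : ∀ c q → locate ls₀ i ≡ just (c , q) → ∀ w → w < 4 →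
            leqℕ (2 ∷ 1 ∷ []) (collapse (just (c , q))) w ≡ true →
            Σ ℕ λ j → j < suc (sumℕ ls₀) × leqℕ ls₀ (suc i) j ≡ true × idx j ≡ w
    above zero    zero    li 1 _ _ = itself li
    above zero    zero    li 2 _ _ = 2 , 2<size , leqℕ-suc⁺ ls₀ i 1 li refl refl , refl
    above zero    (suc q) li 2 _ _ = itself li
    above (suc c) q       li 3 _ _ = itself li
    above zero    zero    li 0 _ ()
    above zero    zero    li 3 _ ()
    above zero    (suc q) li 0 _ ()
    above zero    (suc q) li 1 _ ()
    above zero    (suc q) li 3 _ ()
    above (suc c) q       li 0 _ ()
    above (suc c) q       li 1 _ ()
    above (suc c) q       li 2 _ ()
    above _       _       li (suc (suc (suc (suc w)))) (s≤s (s≤s (s≤s (s≤s ())))) _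

-- Folding 𝕋(1^m) onto 𝕋(1^k) for k ≤ m

ones : ℕ → List ℕ
ones m = chainLengths (sig-1^ m)

locate-ones : ∀ {m i} → i < m → locate (ones m) i ≡ just (i , 0)
locate-ones {suc m} {zero}  _       = refl
locate-ones {suc m} {suc i} (s≤s i<m) rewrite locate-ones i<m = refl

sumℕ-ones : ∀ m → sumℕ (ones m) ≡ m
sumℕ-ones zero    = refl
sumℕ-ones (suc m) = cong suc (sumℕ-ones m)

<size-ones⁻ : ∀ m {i} → i < suc (sumℕ (ones m)) → i ≤ m
<size-ones⁻ m {i} i< = ℕ.≤-pred (Eq.subst (i <_) (cong suc (sumℕ-ones m)) i<)

<size-ones⁺ : ∀ m {i} → i ≤ m → i < suc (sumℕ (ones m))
<size-ones⁺ m {i} i≤m = Eq.subst (i <_) (cong suc (sym (sumℕ-ones m))) (s≤s i≤m)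

leqℕ-ones : ∀ {m i j} → i < m → j < m → leqℕ (ones m) (suc i) (suc j) ≡ true → i ≡ j
leqℕ-ones {m} {i} {j} i<m j<m i≼j
  with c , q , q′ , li , lj , _ ← leqℕ-suc⁻ (ones m) i j i≼j
  with refl ← trans (sym li) (locate-ones i<m)
  with refl ← trans (sym lj) (locate-ones j<m) = refl

onto-1^ : ∀ {m k} → suc k ≤ m → IndexPMorphism (ones m) (ones (suc k))
onto-1^ {m} {k} k<m = record
  { idx       = idx
  ; idx-root  = refl
  ; idx-bound = λ { zero _ → <size-ones⁺ (suc k) z≤n ; (suc i) _ → <size-ones⁺ (suc k) (i⊓k<1+k i) }
  ; idx-forth = idx-forth
  ; idx-back  = idx-back
  }
  where
  idx : ℕ → ℕ
  idx zero    = 0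
  idx (suc i) = suc (i ⊓ k)

  i⊓k<1+k : ∀ i → i ⊓ k < suc k
  i⊓k<1+k i = s≤s (ℕ.m⊓n≤n i k)

  idx-forth : ∀ i j → i < suc (sumℕ (ones m)) → j < suc (sumℕ (ones m)) →
              leqℕ (ones m) i j ≡ true → leqℕ (ones (suc k)) (idx i) (idx j) ≡ true
  idx-forth zero    j       _   _   _ = refl
  idx-forth (suc i) (suc j) i<s j<s i≼j with refl ← leqℕ-ones (<size-ones⁻ m i<s) (<size-ones⁻ m j<s) i≼j
    = leqℕ-refl (ones (suc k)) (i ⊓ k) (locate-ones (i⊓k<1+k i))

  idx-back : ∀ i w → i < suc (sumℕ (ones m)) → w < suc (sumℕ (ones (suc k))) →
             leqℕ (ones (suc k)) (idx i) w ≡ true →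
             Σ ℕ λ j → j < suc (sumℕ (ones m)) × leqℕ (ones m) i j ≡ true × idx j ≡ w
  idx-back zero zero _ _ _ = 0 , s≤s z≤n , refl , refl
  idx-back zero (suc t) _ w<s _ =
    suc t , <size-ones⁺ m (ℕ.≤-trans (<size-ones⁻ (suc k) w<s) k<m) , refl ,
    cong suc (ℕ.m≤n⇒m⊓n≡m (ℕ.≤-pred (<size-ones⁻ (suc k) w<s)))
  idx-back (suc i) (suc u) i<s w<s i≼w
    with refl ← leqℕ-ones (i⊓k<1+k i) (<size-ones⁻ (suc k) w<s) i≼w
    = suc i , i<s , leqℕ-refl (ones m) i (locate-ones (<size-ones⁻ m i<s)) , refl

data Shape : Signature → Set where
  two-chains : ∀ {α} n l ls → chainLengths α ≡ suc (suc n) ∷ suc l ∷ ls → Shape α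
  ones-only  : ∀ m → 1 ≤ m → Shape (sig-1^ m)

shape : ∀ α → ValidSig α → α ≢ sig-ε → (∀ n → 1 ≤ n → α ≢ sig-n¹ n) → Shape α
shape []                                   _ α≢ε _ = ⊥-elim (α≢ε refl)
shape ((n , 1) ∷ [])                       (_ , ap∷ 1≤n _ _) _ α≢n¹ = ⊥-elim (α≢n¹ n 1≤n refl)
shape ((1 , suc (suc m)) ∷ [])             _ _ _ = ones-only (suc (suc m)) (s≤s z≤n)
shape ((suc (suc n) , suc (suc m)) ∷ [])   _ _ _ = two-chains n (suc n) _ refl
shape ((n , m) ∷ (n′ , m′) ∷ α)           (sd∷ n′<n _ , ap∷ _ 1≤m (ap∷ 1≤n′ 1≤m′ _)) _ _ =
  two-leading-chains n′<n 1≤m 1≤n′ 1≤m′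
  where
  two-leading-chains : ∀ {n m n′ m′} → n′ < n → 1 ≤ m → 1 ≤ n′ → 1 ≤ m′ → Shape ((n , m) ∷ (n′ , m′) ∷ α)
  two-leading-chains {suc (suc n)} {1}           {suc l} {suc _} _ _ _ _ = two-chains n l _ refl
  two-leading-chains {suc (suc n)} {suc (suc m)} {suc _} {_}     _ _ _ _ = two-chains n (suc n) _ refl
  two-leading-chains {1} {_} {suc _} (s≤s ())
shape ((zero , suc (suc m)) ∷ [])          (_ , ap∷ () _ _) _ _
shape ((_ , zero) ∷ [])                    (_ , ap∷ _ () _) _ _

χ-from-2·1 : ∀ {Λ} α n l ls → chainLengths α ≡ suc (suc n) ∷ suc l ∷ ls →
  Λ ⊢ χ (𝕋 sig-2·1) → Λ ⊢ χ (𝕋 α)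
χ-from-2·1 {Λ} α n l ls eq ⊢χ = Eq.subst (λ ls → Λ ⊢ χ (TL ls)) (sym eq) (χ-TL-pullback (onto-2·1 n l ls) ⊢χ)

≈SFL-intro : ∀ {Λ Λ′ : Signature → Set} →
  (∀ α → Λ α → Λ′ ⊢ χ (𝕋 α)) → (∀ α → Λ′ α → Λ ⊢ χ (𝕋 α)) → Λ ≈SFL Λ′
≈SFL-intro Λ⊆Λ′ Λ′⊆Λ A = mk⇔ (⊢-resp-axioms Λ⊆Λ′) (⊢-resp-axioms Λ′⊆Λ)

lemma6p28 : (Λ : Signature → Set)
    → (∀ α → Λ α → In𝒮 α)
    → Λ sig-2·1
    → ¬ Λ sig-ε
    → (∀ n → 1 ≤ n → ¬ Λ (sig-n¹ n))
    → ((∀ k → 1 ≤ k → ¬ Λ (sig-1^ k)) → Λ ≈SFL ⟦ sig-2·1 ∷ [] ⟧)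
    × (∀ k → 1 ≤ k → Λ (sig-1^ k) → (∀ j → 1 ≤ j → j < k → ¬ Λ (sig-1^ j))
    → Λ ≈SFL ⟦ sig-2·1 ∷ sig-1^ k ∷ [] ⟧)
lemma6p28 Λ Λ⊆𝒮 2·1∈Λ ε∉Λ n¹∉Λ = without-ones , with-ones
  where
  shape∈Λ : ∀ α → Λ α → Shape α
  shape∈Λ α α∈Λ = shape α (proj₁ (Λ⊆𝒮 α α∈Λ)) (λ { refl → ε∉Λ α∈Λ }) (λ { n 1≤n refl → n¹∉Λ n 1≤n α∈Λ })

  without-ones : (∀ k → 1 ≤ k → ¬ Λ (sig-1^ k)) → Λ ≈SFL ⟦ sig-2·1 ∷ [] ⟧
  without-ones no-ones = ≈SFL-intro derive (λ { _ (inj₁ refl) → ax-χ 2·1∈Λ })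
    where
    derive : ∀ α → Λ α → ⟦ sig-2·1 ∷ [] ⟧ ⊢ χ (𝕋 α)
    derive α α∈Λ with shape∈Λ α α∈Λ
    ... | two-chains n l ls eq = χ-from-2·1 α n l ls eq (ax-χ (inj₁ refl))
    ... | ones-only m 1≤m      = ⊥-elim (no-ones m 1≤m α∈Λ)

  with-ones : ∀ k → 1 ≤ k → Λ (sig-1^ k) → (∀ j → 1 ≤ j → j < k → ¬ Λ (sig-1^ j))
    → Λ ≈SFL ⟦ sig-2·1 ∷ sig-1^ k ∷ [] ⟧
  with-ones (suc k) _ 1^k∈Λ k-minimal =
    ≈SFL-intro derive (λ { _ (inj₁ refl) → ax-χ 2·1∈Λ ; _ (inj₂ (inj₁ refl)) → ax-χ 1^k∈Λ })
    where
    derive : ∀ α → Λ α → ⟦ sig-2·1 ∷ sig-1^ (suc k) ∷ [] ⟧ ⊢ χ (𝕋 α)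
    derive α α∈Λ with shape∈Λ α α∈Λ
    ... | two-chains n l ls eq = χ-from-2·1 α n l ls eq (ax-χ (inj₁ refl))
    ... | ones-only m 1≤m with suc k ≤? m
    ...   | yes k<m = χ-TL-pullback (onto-1^ k<m) (ax-χ (inj₂ (inj₁ refl)))
    ...   | no  k≮m = ⊥-elim (k-minimal m 1≤m (ℕ.≰⇒> k≮m) α∈Λ)
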